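{- Let $m,n\ge1$. The map $\phi:\mathsf{EW}_{m,n}\to\mathsf{LRib}_{m,n}$ described in the context is surjective: for every $(R,\ell)\in\mathsf{LRib}_{m,n}$ there exists $T\in\mathsf{EW}_{m,n}$ with $\phi(T)=(R,\ell)$.
   Context: All tableaux are $0/1$ arrays; $T_{ij}$ denotes the entry in row $i$ (rows numbered top to bottom) and column $j$ (columns numbered left to right). Labels are symbols $v_0,v_1,\dots,v_{m+n-1}$, ordered by $v_i<v_j$ iff $i<j$. Rectangular EW-tableau: an $m\times n$ $0/1$ tableau $T$ such that (i) every entry of the top row is $1$; (ii) every other row contains at least one $0$; (iii) there are no rows $i\ne i'$ and columns $k\ne k'$ with $T_{ik}=T_{i'k'}=0$ and $T_{ik'}=T_{i'k}=1$. $\mathsf{EW}_{m,n}$ is the set of these. The rows of $T$ are labelled $v_0,\dots,v_{m-1}$ from top to bottom and the columns $v_m,\dots,v_{m+n-1}$ from left to right. Parallelogram polyomino of type $(m,n)$: an $m\times n$ $0/1$ tableau $P$ with $P_{11}=P_{mn}=1$, such that every row contains at least one $1$ and the $1$s in each row are contiguous, and for each $2\le i\le m$: the leftmost $1$ of row $i$ is weakly to the right of the leftmost $1$ of row $i-1$ and weakly to the left of the rightmost $1$ of row $i-1$, and the rightmost $1$ of row $i$ is weakly to the right of the rightmost $1$ of row $i-1$. It is a ribbon parallelogram polyomino if it has exactly $m+n-1$ entries equal to $1$. Labelled parallelogram polyomino of type $(m,n)$: a pair $(P,\ell)$ with $P$ a parallelogram polyomino of type $(m,n)$ and $\ell=(\ell(\mathrm{row}_1),\dots,\ell(\mathrm{row}_m),\ell(\mathrm{col}_1),\dots,\ell(\mathrm{col}_n))$,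 where the row labels are a permutation of $\{v_0,\dots,v_{m-1}\}$ with $\ell(\mathrm{row}_1)=v_0$ and such that the labels of rows whose leftmost $1$s lie in the same column are increasing from top to bottom, and the column labels are a permutation of $\{v_m,\dots,v_{m+n-1}\}$ such that the labels of columns whose topmost $1$s lie in the same row are increasing from left to right. $\mathsf{LRib}_{m,n}$ is the set of those with $P$ a ribbon parallelogram polyomino. The map $\phi$: given $T\in\mathsf{EW}_{m,n}$ with its labels, (1) permute the columns (carrying their labels) so that every entry to the left of a $0$ is a $0$, with identical columns placed so their labels increase from left to right; (2) then permute the rows (carrying labels) so that every entry above a $1$ is a $1$, with identical rows placed so their labels increase from top to bottom; call the result $T'$ and the resulting labelling $\ell$. (3) Let $R$ be the $m\times n$ tableau with $R_{ij}=1$ if either [$T'_{ij}=1$ and ($i=m$ or $T'_{i+1,j}=0$)] or [$T'_{ij}=0$ and ($j=n$ or $T'_{i,j+1}=1$)], and $R_{ij}=0$ otherwise. Set $\phi(T)=(R,\ell)$; this lies in $\mathsf{LRib}_{m,n}$. -}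

module Defs where

open import Data.Bool using (Bool; true; false; if_then_else_)
open import Data.Nat using (ℕ; zero; suc; _≤_; _<_)
open import Data.Fin using (Fin; toℕ)
import Data.Fin as F
open import Data.List using (List; map; allFin)
open import Data.Nat.ListAction using (sum)
open import Data.Product using (Σ; ∃; _×_; _,_)
open import Data.Sum using (_⊎_)
open import Relation.Nullary using (¬_)
open import Relation.Binary.PropositionalEquality using (_≡_; _≢_)
open import Function.Definitions using (Bijective)
open import Function.Bundles using (_⇔_)

-- A 0/1 tableau with m rows and n columns; entry 1 is `true`, 0 is `false`.
-- T i j is the entry in row i (0-based from the top) and column j (0-based from the left).
Tableau : ℕ → ℕ → Set
Tableau m n = Fin m → Fin n → Bool

-- Row labels are v_0,…,v_{m-1}: the row label v_k is encoded as k : Fin m.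
-- Column labels are v_m,…,v_{m+n-1}: the column label v_{m+k} is encoded as k : Fin n.
-- The order v_i < v_j iff i < j is then the order of Fin within each group.
RowLabelling : ℕ → Set
RowLabelling m = Fin m → Fin m

ColLabelling : ℕ → Set
ColLabelling n = Fin n → Fin n

IsPerm : ∀ {k} → (Fin k → Fin k) → Set
IsPerm f = Bijective _≡_ _≡_ f

record IsEW {m n : ℕ} (T : Tableau m n) : Set where
  field
    topRowOnes   : ∀ (i : Fin m) (j : Fin n) → toℕ i ≡ 0 → T i j ≡ true
    otherRowZero : ∀ (i : Fin m) → toℕ i ≢ 0 → ∃ λ (j : Fin n) → T i j ≡ false
    noPattern    : ∀ (i i' : Fin m) (k k' : Fin n) → i ≢ i' → k ≢ k' →
                   ¬ (T i k ≡ false × T i' k' ≡ false × T i k' ≡ true × T i' k ≡ true)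

LeftmostOne : ∀ {m n} → Tableau m n → Fin m → Fin n → Set
LeftmostOne P i j = P i j ≡ true × (∀ k → k F.< j → P i k ≡ false)

RightmostOne : ∀ {m n} → Tableau m n → Fin m → Fin n → Set
RightmostOne P i j = P i j ≡ true × (∀ k → j F.< k → P i k ≡ false)

TopmostOne : ∀ {m n} → Tableau m n → Fin n → Fin m → Set
TopmostOne P j i = P i j ≡ true × (∀ k → k F.< i → P k j ≡ false)

record IsParallelogram {m n : ℕ} (P : Tableau m n) : Set where
  field
    firstCell  : ∀ (i : Fin m) (j : Fin n) → toℕ i ≡ 0 → toℕ j ≡ 0 → P i j ≡ true
    lastCell   : ∀ (i : Fin m) (j : Fin n) → suc (toℕ i) ≡ m → suc (toℕ j) ≡ n → P i j ≡ true
    rowHasOne  : ∀ (i : Fin m) → ∃ λ (j : Fin n) → P i j ≡ true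
    contiguous : ∀ (i : Fin m) (j k l : Fin n) → j F.≤ k → k F.≤ l →
                 P i j ≡ true → P i l ≡ true → P i k ≡ true
    -- for consecutive rows i (= row i-1 of the paper) and i' (= row i of the paper)
    consecutive : ∀ (i i' : Fin m) → toℕ i' ≡ suc (toℕ i) →
                  ∀ (a b a' b' : Fin n) →
                  LeftmostOne P i a → RightmostOne P i b →
                  LeftmostOne P i' a' → RightmostOne P i' b' →
                  (a F.≤ a' × a' F.≤ b) × b F.≤ b'

countOnes : ∀ {m n} → Tableau m n → ℕ
countOnes {m} {n} P =
  sum (map (λ i → sum (map (λ j → if P i j then 1 else 0) (allFin n))) (allFin m))

record IsRibbon {m n : ℕ} (P : Tableau m n) : Set where
  field
    parallelogram : IsParallelogram P
    ones          : countOnes P ≡ (m Data.Nat.+ n) Data.Nat.∸ 1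

record IsLRib {m n : ℕ} (P : Tableau m n) (ℓr : RowLabelling m) (ℓc : ColLabelling n) : Set where
  field
    ribbon     : IsRibbon P
    rowPerm    : IsPerm ℓr
    firstRowV0 : ∀ (i : Fin m) → toℕ i ≡ 0 → toℕ (ℓr i) ≡ 0
    colPerm    : IsPerm ℓc
    rowsInc    : ∀ (i i' : Fin m) (j : Fin n) → i F.< i' →
                 LeftmostOne P i j → LeftmostOne P i' j → ℓr i F.< ℓr i'
    colsInc    : ∀ (j j' : Fin n) (i : Fin m) → j F.< j' →
                 TopmostOne P j i → TopmostOne P j' i → ℓc j F.< ℓc j'

-- The map φ, described as the relation "φ(T) = (R , ℓr , ℓc)".
-- Position j of the column-permuted tableau holds the original column ℓc j
-- (whose label is v_{m + ℓc j}); position i of T' holds the original row ℓr i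
-- (whose label is v_{ℓr i}).  Hence the output labelling equals the permutations.

RibbonCell : ∀ {m n} → Tableau m n → Fin m → Fin n → Set
RibbonCell {m} {n} T' i j =
    (T' i j ≡ true  × (∀ (i' : Fin m) → toℕ i' ≡ suc (toℕ i) → T' i' j ≡ false))
  ⊎ (T' i j ≡ false × (∀ (j' : Fin n) → toℕ j' ≡ suc (toℕ j) → T' i j' ≡ true))

record PhiMapsTo {m n : ℕ} (T : Tableau m n) (R : Tableau m n)
                 (ℓr : RowLabelling m) (ℓc : ColLabelling n) : Set where
  T₁ : Tableau m n
  T₁ i j = T i (ℓc j)
  T' : Tableau m n
  T' i j = T (ℓr i) (ℓc j)
  field
    colPerm   : IsPerm ℓc
    step1     : ∀ (i : Fin m) (j k : Fin n) → k F.< j → T₁ i j ≡ false → T₁ i k ≡ false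
    step1ties : ∀ (j j' : Fin n) → j F.< j' → (∀ (i : Fin m) → T₁ i j ≡ T₁ i j') → ℓc j F.< ℓc j'
    rowPerm   : IsPerm ℓr
    step2     : ∀ (i k : Fin m) (j : Fin n) → k F.< i → T' i j ≡ true → T' k j ≡ true
    step2ties : ∀ (i i' : Fin m) → i F.< i' → (∀ (j : Fin n) → T' i j ≡ T' i' j) → ℓr i F.< ℓr i'
    result    : ∀ (i : Fin m) (j : Fin n) → (R i j ≡ true) ⇔ RibbonCell T' i j

-- A ribbon parallelogram polyomino R has rows that are intervals [aᵢ, bᵢ] of columns with
-- a₀ = 0, b_{m-1} = n-1 and aᵢ₊₁ ≤ bᵢ; its m + n - 1 cells force the telescoping sum of
-- row lengths to be tight, i.e. bᵢ = aᵢ₊₁.  So the sorted tableau T' of any preimage is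
-- forced: its top row is all ones and row i > 0 has its zeros exactly in columns ≤ aᵢ.
-- This staircase is an EW-tableau already in the shape produced by steps (1) and (2); its
-- equal rows are rows with equal aᵢ and its equal columns are columns with the same topmost
-- cell in R, so the tie-breaking rules are the increasing-label conditions of LRib, and
-- step (3) recovers R.  Undoing the labelling permutations gives the preimage T.

module Submission where

open import Data.Bool using (Bool; true; false; if_then_else_)
open import Data.Bool.Properties using (¬-not) renaming (_≟_ to _≟ᵇ_)
open import Data.Nat using (ℕ; zero; suc; _≤_; _<_; _+_; _∸_; z≤n; s≤s; s≤s⁻¹)
open import Data.Nat.Properties
open import Data.Nat.Tactic.RingSolver using (solve-∀)
open import Data.Fin using (Fin; zero; suc; toℕ; fromℕ; inject₁)
import Data.Fin as F
open import Data.Fin.Properties using (any?; toℕ-injective; toℕ-inject₁; toℕ<n; toℕ≤pred[n]; toℕ-fromℕ)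
open import Data.List using (map; allFin; tabulate)
open import Data.List.Properties using (map-tabulate; tabulate-cong)
open import Data.Nat.ListAction using (sum)
open import Data.Product using (∃; _×_; _,_; proj₁; proj₂)
open import Data.Sum using (_⊎_; inj₁; inj₂)
open import Function using (_∘_; _$_)
open import Function.Bundles using (Inverse; Injection; _↔_; mk⤖; mk⇔)
open import Function.Properties.Bijection using (⤖⇒↔)
open import Function.Properties.Inverse using (↔-sym; ↔⇒↣)
open import Relation.Nullary using (¬_; Dec; yes; no; does; contradiction)
open import Relation.Nullary.Decidable using (dec-true; dec-false)
open import Relation.Unary using (Pred; Decidable)
open import Relation.Binary.PropositionalEquality
open ≡-Reasoning
open import Defs

does-true⇒ : ∀ {a} {A : Set a} (A? : Dec A) → does A? ≡ true → A
does-true⇒ (yes a) _ = a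

does-false⇒ : ∀ {a} {A : Set a} (A? : Dec A) → does A? ≡ false → ¬ A
does-false⇒ (no ¬a) _ = ¬a

least : ∀ {n p} {P : Pred (Fin n) p} → Decidable P → ∃ P →
        ∃ λ i → P i × (∀ j → j F.< i → ¬ P j)
least {suc n} P? (i , Pi) with P? zero
... | yes P₀ = zero , P₀ , λ _ ()
least {suc n} P? (zero  , P₀) | no ¬P₀ = contradiction P₀ ¬P₀
least {suc n} P? (suc i , Pi) | no ¬P₀ =
  let j , Pj , below = least (P? ∘ suc) (i , Pi)
  in suc j , Pj , λ { zero _ → ¬P₀ ; (suc k) (s≤s k<j) → below k k<j }

greatest : ∀ {n p} {P : Pred (Fin n) p} → Decidable P → ∃ P →
           ∃ λ i → P i × (∀ j → i F.< j → ¬ P j)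
greatest {suc n} P? (i , Pi) with any? (P? ∘ suc)
... | yes ∃P₊ = let j , Pj , above = greatest (P? ∘ suc) ∃P₊
                in suc j , Pj , λ { (suc k) (s≤s j<k) → above k j<k }
greatest {suc n} P? (zero  , P₀) | no ¬∃P₊ = zero , P₀ , λ { (suc k) _ Pk → ¬∃P₊ (k , Pk) }
greatest {suc n} P? (suc i , Pi) | no ¬∃P₊ = contradiction (i , Pi) ¬∃P₊

last-or-next : ∀ {k} (i : Fin (suc k)) → i ≡ fromℕ k ⊎ ∃ λ (i' : Fin (suc k)) → toℕ i' ≡ suc (toℕ i)
last-or-next {zero}  zero    = inj₁ refl
last-or-next {suc k} zero    = inj₂ (suc zero , refl)
last-or-next {suc k} (suc i) with last-or-next i
... | inj₁ i≡last     = inj₁ (cong suc i≡last)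
... | inj₂ (i' , i'≡) = inj₂ (suc i' , cong suc i'≡)

successor-view : ∀ {k} {i i' : Fin (suc k)} → toℕ i' ≡ suc (toℕ i) →
                 ∃ λ p → i ≡ inject₁ p × i' ≡ suc p
successor-view {suc k} {i} {suc p} e =
  p , toℕ-injective (trans (sym (suc-injective e)) (sym (toℕ-inject₁ p))) , refl

next≢zero : ∀ {k} {i i' : Fin (suc k)} → toℕ i' ≡ suc (toℕ i) → i' ≢ zero
next≢zero next refl = 0≢1+n next

above≢zero : ∀ {k} {i i' : Fin (suc k)} → i F.< i' → i' ≢ zero
above≢zero i<i' refl = n≮0 i<i'

monotone-by-steps : ∀ {k} (f : Fin (suc k) → ℕ) → (∀ p → f (inject₁ p) ≤ f (suc p)) →
                    ∀ {x y} → x F.≤ y → f x ≤ f y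
monotone-by-steps f step {zero}  {zero}  _ = ≤-refl
monotone-by-steps {suc k} f step {zero}  {suc y} _ =
  ≤-trans (step zero) (monotone-by-steps (f ∘ suc) (step ∘ suc) {zero} {y} z≤n)
monotone-by-steps {suc k} f step {suc x} {suc y} (s≤s x≤y) =
  monotone-by-steps (f ∘ suc) (step ∘ suc) x≤y

count-interval : ∀ {n} (g : Fin n → Bool) {a c} → a ≤ c → c ≤ n →
  (∀ j → g j ≡ true → a ≤ toℕ j × toℕ j < c) →
  (∀ j → a ≤ toℕ j → toℕ j < c → g j ≡ true) →
  sum (tabulate (λ j → if g j then 1 else 0)) ≡ c ∸ a
count-interval {zero} g z≤n z≤n _ _ = refl
count-interval {suc n} g {zero} {zero} _ _ inside _ with g zero in g₀
... | true  = contradiction (proj₂ (inside zero g₀)) (λ ())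
... | false = count-interval (g ∘ suc) z≤n z≤n
                (λ j gj → contradiction (proj₂ (inside (suc j) gj)) (λ ())) (λ _ _ ())
count-interval {suc n} g {zero} {suc c} _ (s≤s c≤n) inside fill
  rewrite fill zero z≤n (s≤s z≤n) =
  cong suc (count-interval (g ∘ suc) z≤n c≤n
    (λ j gj → z≤n , s≤s⁻¹ (proj₂ (inside (suc j) gj)))
    (λ j _ j<c → fill (suc j) z≤n (s≤s j<c)))
count-interval {suc n} g {suc a} {suc c} (s≤s a≤c) (s≤s c≤n) inside fill with g zero in g₀
... | true  = contradiction (proj₁ (inside zero g₀)) (λ ())
... | false = count-interval (g ∘ suc) a≤c c≤n
                (λ j gj → let a<j , j<c = inside (suc j) gj in s≤s⁻¹ a<j , s≤s⁻¹ j<c)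
                (λ j a≤j j<c → fill (suc j) (s≤s a≤j) (s≤s j<c))

telescope : ∀ k (a b : Fin (suc k) → ℕ) →
  (∀ i → a i ≤ suc (b i)) → (∀ p → a (suc p) ≤ b (inject₁ p)) →
  sum (tabulate (λ i → suc (b i) ∸ a i)) + a zero
    ≡ suc k + b (fromℕ k) + sum (tabulate (λ p → b (inject₁ p) ∸ a (suc p)))
telescope zero a b a≤1+b _ = begin
  suc (b zero) ∸ a zero + 0 + a zero  ≡⟨ cong (_+ a zero) (+-identityʳ _) ⟩
  suc (b zero) ∸ a zero + a zero      ≡⟨ m∸n+n≡m (a≤1+b zero) ⟩
  suc (b zero)                        ≡⟨ +-identityʳ _ ⟨
  suc (b zero) + 0                    ∎
telescope (suc k) a b a≤1+b a≤b = begin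
  c + s + a zero           ≡⟨ swap c s (a zero) ⟩
  c + a zero + s           ≡⟨ cong (_+ s) (m∸n+n≡m (a≤1+b zero)) ⟩
  suc (b zero) + s         ≡⟨ cong (λ x → suc x + s) (m∸n+n≡m (a≤b zero)) ⟨
  suc (g + a₁) + s         ≡⟨ cong suc (swap g a₁ s) ⟩
  suc (g + s + a₁)         ≡⟨ cong suc (+-assoc g s a₁) ⟩
  suc (g + (s + a₁))       ≡⟨ cong (λ x → suc (g + x)) tail ⟩
  suc (g + (suc k + bₗ + d)) ≡⟨ regroup g (suc k) bₗ d ⟩
  suc (suc k) + bₗ + (g + d) ∎
  where
  c s g a₁ bₗ d : ℕ
  c = suc (b zero) ∸ a zero
  s = sum (tabulate (λ i → suc (b (suc i)) ∸ a (suc i)))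
  g = b zero ∸ a (suc zero)
  a₁ = a (suc zero)
  bₗ = b (fromℕ (suc k))
  d = sum (tabulate (λ p → b (suc (inject₁ p)) ∸ a (suc (suc p))))
  tail : s + a₁ ≡ suc k + bₗ + d
  tail = telescope k (a ∘ suc) (b ∘ suc) (a≤1+b ∘ suc) (a≤b ∘ suc)
  swap : ∀ x y z → x + y + z ≡ x + z + y
  swap = solve-∀
  regroup : ∀ x y z w → suc (x + (y + z + w)) ≡ suc y + z + (x + w)
  regroup = solve-∀

sum-tabulate≡0 : ∀ {k} (f : Fin k → ℕ) → sum (tabulate f) ≡ 0 → ∀ i → f i ≡ 0
sum-tabulate≡0 f s≡0 zero    = m+n≡0⇒m≡0 (f zero) s≡0
sum-tabulate≡0 f s≡0 (suc i) = sum-tabulate≡0 (f ∘ suc) (m+n≡0⇒n≡0 (f zero) s≡0) i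

IsEW-permute : ∀ {k n} {S : Tableau (suc k) n} (σ : Fin (suc k) ↔ Fin (suc k)) (τ : Fin n ↔ Fin n) →
               Inverse.to σ zero ≡ zero → IsEW S →
               IsEW (λ i j → S (Inverse.to σ i) (Inverse.to τ j))
IsEW-permute {S = S} σ τ σ₀ ew = record
  { topRowOnes   = λ { zero j _ → subst (λ x → S x _ ≡ true) (sym σ₀) (topRowOnes zero _ refl) }
  ; otherRowZero = λ i i≢0 →
      let j , Sij = otherRowZero (σ.to i) (i≢0 ∘ σ-zero⇒ i)
      in τ.from j , subst (λ y → S (σ.to i) y ≡ false) (sym (τ.strictlyInverseˡ j)) Sij
  ; noPattern    = λ i i' c c' i≢i' c≢c' →
      noPattern (σ.to i) (σ.to i') (τ.to c) (τ.to c') (i≢i' ∘ injective σ) (c≢c' ∘ injective τ)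
  }
  where
  open IsEW ew
  module σ = Inverse σ
  module τ = Inverse τ
  injective : ∀ {m} (π : Fin m ↔ Fin m) {x y} → Inverse.to π x ≡ Inverse.to π y → x ≡ y
  injective π = Injection.injective (↔⇒↣ π)
  σ-zero⇒ : ∀ i → toℕ (σ.to i) ≡ 0 → toℕ i ≡ 0
  σ-zero⇒ i e = cong toℕ (injective σ (trans (toℕ-injective e) (sym σ₀)))

RibbonCell-cong : ∀ {m n} {X Y : Tableau m n} → (∀ i j → X i j ≡ Y i j) →
                  ∀ {i j} → RibbonCell X i j → RibbonCell Y i j
RibbonCell-cong X≡Y {i} {j} (inj₁ (Xij , below)) =
  inj₁ (trans (sym (X≡Y i j)) Xij , λ i' next → trans (sym (X≡Y i' j)) (below i' next))
RibbonCell-cong X≡Y {i} {j} (inj₂ (Xij , beside)) =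
  inj₂ (trans (sym (X≡Y i j)) Xij , λ j' next → trans (sym (X≡Y i j')) (beside j' next))

module Staircase {k} (a : Fin (suc k) → ℕ) where

  stair : ∀ {n} → Tableau (suc k) n
  stair zero    j = true
  stair (suc x) j = does (a (suc x) <? toℕ j)

  stair-true : ∀ {n} x (j : Fin n) → a x < toℕ j → stair x j ≡ true
  stair-true zero    j _   = refl
  stair-true (suc x) j a<j = dec-true (a (suc x) <? toℕ j) a<j

  stair-false : ∀ {n} x (j : Fin n) → x ≢ zero → toℕ j ≤ a x → stair x j ≡ false
  stair-false zero    j x≢0 _   = contradiction refl x≢0
  stair-false (suc x) j _   j≤a = dec-false (a (suc x) <? toℕ j) (≤⇒≯ j≤a)

  stair-true⇒ : ∀ {n} x (j : Fin n) → stair x j ≡ true → x ≡ zero ⊎ a x < toℕ j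
  stair-true⇒ zero    j _ = inj₁ refl
  stair-true⇒ (suc x) j e = inj₂ (does-true⇒ (a (suc x) <? toℕ j) e)

  stair-false⇒ : ∀ {n} x (j : Fin n) → stair x j ≡ false → x ≢ zero × toℕ j ≤ a x
  stair-false⇒ zero    j ()
  stair-false⇒ (suc x) j e = (λ ()) , ≮⇒≥ (does-false⇒ (a (suc x) <? toℕ j) e)

  stair-isEW : ∀ {n} → IsEW (stair {suc n})
  stair-isEW {n} = record
    { topRowOnes   = λ { zero j _ → refl }
    ; otherRowZero = λ { zero x≢0 → contradiction refl x≢0
                       ; (suc x) _ → zero , stair-false {suc n} (suc x) zero (λ ()) z≤n }
    ; noPattern    = noPattern
    }
    where
    noPattern : ∀ i i' (c c' : Fin _) → i ≢ i' → c ≢ c' →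
                ¬ (stair i c ≡ false × stair i' c' ≡ false × stair i c' ≡ true × stair i' c ≡ true)
    noPattern i i' c c' _ _ (f , f' , t , t')
      with stair-false⇒ i c f | stair-false⇒ i' c' f' | stair-true⇒ i c' t | stair-true⇒ i' c t'
    ... | i≢0 , _ | _ | inj₁ i≡0 | _ = i≢0 i≡0
    ... | _ | i'≢0 , _ | _ | inj₁ i'≡0 = i'≢0 i'≡0
    ... | _ , c≤a | _ , c'≤a' | inj₂ a<c' | inj₂ a'<c =
      <-irrefl refl (<-≤-trans a<c' (≤-trans c'≤a' (<⇒≤ (<-≤-trans a'<c c≤a))))

  stair-zerosLeft : ∀ {n} x {c c' : Fin n} → c F.< c' → stair x c' ≡ false → stair x c ≡ false
  stair-zerosLeft x {c} {c'} c<c' f =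
    let x≢0 , c'≤a = stair-false⇒ x c' f in stair-false x c x≢0 (≤-trans (<⇒≤ c<c') c'≤a)

  stair-onesUp : (∀ {x y} → x F.≤ y → a x ≤ a y) →
                 ∀ {n} {x x'} (j : Fin n) → x' F.< x → stair x j ≡ true → stair x' j ≡ true
  stair-onesUp mono {x = x} {x'} j x'<x t with stair-true⇒ x j t
  ... | inj₁ refl  = contradiction x'<x n≮0
  ... | inj₂ a<j = stair-true x' j (≤-<-trans (mono (<⇒≤ x'<x)) a<j)

module Parallelogram {k n} {P : Tableau (suc k) (suc n)} (par : IsParallelogram P) where
  open IsParallelogram par

  leftmost : ∀ i → ∃ (LeftmostOne P i)
  leftmost i = let j , Pij , before = least (λ j → P i j ≟ᵇ true) (rowHasOne i)
               in j , Pij , λ c c<j → ¬-not (before c c<j)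

  rightmost : ∀ i → ∃ (RightmostOne P i)
  rightmost i = let j , Pij , after = greatest (λ j → P i j ≟ᵇ true) (rowHasOne i)
                in j , Pij , λ c j<c → ¬-not (after c j<c)

  left right : Fin (suc k) → ℕ
  left  i = toℕ (proj₁ (leftmost i))
  right i = toℕ (proj₁ (rightmost i))

  one⇒between : ∀ {i j} → P i j ≡ true → left i ≤ toℕ j × toℕ j ≤ right i
  one⇒between {i} {j} Pij =
      ≮⇒≥ (λ j<l → contradiction (trans (sym Pij) (proj₂ (proj₂ (leftmost i)) j j<l)) λ ())
    , ≮⇒≥ (λ r<j → contradiction (trans (sym Pij) (proj₂ (proj₂ (rightmost i)) j r<j)) λ ())

  between⇒one : ∀ {i j} → left i ≤ toℕ j → toℕ j ≤ right i → P i j ≡ true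
  between⇒one {i} {j} l≤j j≤r =
    contiguous i _ j _ l≤j j≤r (proj₁ (proj₂ (leftmost i))) (proj₁ (proj₂ (rightmost i)))

  left≤right : ∀ i → left i ≤ right i
  left≤right i = proj₂ (one⇒between (proj₁ (proj₂ (leftmost i))))

  left≤n : ∀ i → left i ≤ n
  left≤n i = toℕ≤pred[n] (proj₁ (leftmost i))

  left-top : left zero ≡ 0
  left-top = n≤0⇒n≡0 (proj₁ (one⇒between (firstCell zero zero refl refl)))

  right-bottom : right (fromℕ k) ≡ n
  right-bottom = ≤-antisym (toℕ≤pred[n] (proj₁ (rightmost (fromℕ k))))
    (subst (_≤ right (fromℕ k)) (toℕ-fromℕ n)
      (proj₂ (one⇒between
        (lastCell (fromℕ k) (fromℕ n) (cong suc (toℕ-fromℕ k)) (cong suc (toℕ-fromℕ n))))))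

  rows-overlap : ∀ (p : Fin k) → (left (inject₁ p) ≤ left (suc p) × left (suc p) ≤ right (inject₁ p))
                                 × right (inject₁ p) ≤ right (suc p)
  rows-overlap p = consecutive (inject₁ p) (suc p) (cong suc (sym (toℕ-inject₁ p))) _ _ _ _
    (proj₂ (leftmost (inject₁ p))) (proj₂ (rightmost (inject₁ p)))
    (proj₂ (leftmost (suc p))) (proj₂ (rightmost (suc p)))

  left-mono : ∀ {x y} → x F.≤ y → left x ≤ left y
  left-mono = monotone-by-steps left (proj₁ ∘ proj₁ ∘ rows-overlap)

  sumRowLengths : ℕ
  sumRowLengths = sum (tabulate (λ i → suc (right i) ∸ left i))

  countOnes≡sumRowLengths : countOnes P ≡ sumRowLengths
  countOnes≡sumRowLengths = begin
    sum (map rowCount (allFin (suc k)))  ≡⟨ cong sum (map-tabulate (λ i → i) rowCount) ⟩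
    sum (tabulate rowCount)              ≡⟨ cong sum (tabulate-cong rowLength) ⟩
    sumRowLengths                        ∎
    where
    rowCount : Fin (suc k) → ℕ
    rowCount i = sum (map (λ j → if P i j then 1 else 0) (allFin (suc n)))
    rowLength : ∀ i → rowCount i ≡ suc (right i) ∸ left i
    rowLength i = trans (cong sum (map-tabulate (λ j → j) (λ j → if P i j then 1 else 0)))
      (count-interval (P i) (≤-trans (left≤right i) (n≤1+n _)) (toℕ<n (proj₁ (rightmost i)))
        (λ j Pij → let l≤j , j≤r = one⇒between Pij in l≤j , s≤s j≤r)
        (λ j l≤j j<r → between⇒one l≤j (s≤s⁻¹ j<r)))

  ribbon⇒right≡left-next : countOnes P ≡ suc k + suc n ∸ 1 →
                           ∀ (p : Fin k) → right (inject₁ p) ≡ left (suc p)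
  ribbon⇒right≡left-next ones p =
    ≤-antisym (m∸n≡0⇒m≤n (sum-tabulate≡0 gap (sym (+-cancelˡ-≡ (suc k + n) 0 _ count)) p))
              (proj₂ (proj₁ (rows-overlap p)))
    where
    gap : Fin k → ℕ
    gap p = right (inject₁ p) ∸ left (suc p)
    count : suc k + n + 0 ≡ suc k + n + sum (tabulate gap)
    count = begin
      suc k + n + 0                                  ≡⟨ +-identityʳ _ ⟩
      suc k + n                                      ≡⟨ +-suc k n ⟨
      suc k + suc n ∸ 1                              ≡⟨ ones ⟨
      countOnes P                                    ≡⟨ countOnes≡sumRowLengths ⟩
      sumRowLengths                                  ≡⟨ +-identityʳ _ ⟨
      sumRowLengths + 0                              ≡⟨ cong (sumRowLengths +_) left-top ⟨
      sumRowLengths + left zero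
        ≡⟨ telescope k left right (λ i → ≤-trans (left≤right i) (n≤1+n _))
                                  (proj₂ ∘ proj₁ ∘ rows-overlap) ⟩
      suc k + right (fromℕ k) + sum (tabulate gap)
        ≡⟨ cong (λ r → suc k + r + sum (tabulate gap)) right-bottom ⟩
      suc k + n + sum (tabulate gap)                 ∎

module Preimage {k n} {R : Tableau (suc k) (suc n)}
                {ℓr : RowLabelling (suc k)} {ℓc : ColLabelling (suc n)}
                (L : IsLRib R ℓr ℓc) where
  open IsLRib L
  open Parallelogram (IsRibbon.parallelogram ribbon)
  open Staircase left

  right≡left-next : ∀ {i i'} → toℕ i' ≡ suc (toℕ i) → right i ≡ left i'
  right≡left-next next with successor-view next
  ... | p , refl , refl = ribbon⇒right≡left-next (IsRibbon.ones ribbon) p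

  topRow : ∀ (j : Fin (suc n)) → ∃ λ x → toℕ j ≤ right x × (∀ y → y F.< x → right y < toℕ j)
  topRow j =
    let x , j≤r , above = least (λ x → toℕ j ≤? right x)
                                (fromℕ k , subst (toℕ j ≤_) (sym right-bottom) (toℕ≤pred[n] j))
    in x , j≤r , λ y y<x → ≰⇒> (above y y<x)

  left≤column-below : ∀ {j : Fin (suc n)} x → (∀ y → y F.< x → right y < toℕ j) → left x ≤ toℕ j
  left≤column-below {j} zero    _     = subst (_≤ toℕ j) (sym left-top) z≤n
  left≤column-below {j} (suc p) above = <⇒≤ $
    subst (_< toℕ j) (right≡left-next (cong suc (sym (toℕ-inject₁ p))))
          (above (inject₁ p) (s≤s (≤-reflexive (toℕ-inject₁ p))))

  topmostOne : ∀ {j x} → toℕ j ≤ right x → (∀ y → y F.< x → right y < toℕ j) → TopmostOne R j x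
  topmostOne {j} {x} j≤r above =
      between⇒one (left≤column-below x above) j≤r
    , λ y y<x → ¬-not λ Ryj → <⇒≱ (above y y<x) (proj₂ (one⇒between Ryj))

  covers-identical-column : ∀ {j j' : Fin (suc n)} {x} → (∀ y → stair y j ≡ stair y j') →
                            toℕ j ≤ right x → toℕ j' ≤ right x
  covers-identical-column {j} {j'} {x} same j≤r with last-or-next x
  ... | inj₁ refl = subst (toℕ j' ≤_) (sym right-bottom) (toℕ≤pred[n] j')
  ... | inj₂ (x' , next) =
    let j≤l  = subst (toℕ j ≤_) (right≡left-next next) j≤r
        Sx'j = stair-false x' j (next≢zero next) j≤l
    in subst (toℕ j' ≤_) (sym (right≡left-next next))
             (proj₂ (stair-false⇒ x' j' (trans (sym (same x')) Sx'j)))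

  stair-colTies : ∀ j j' → j F.< j' → (∀ x → stair x j ≡ stair x j') → ℓc j F.< ℓc j'
  stair-colTies j j' j<j' same =
    let x , j≤r , above = topRow j
    in colsInc j j' x j<j' (topmostOne j≤r above)
         (topmostOne (covers-identical-column same j≤r) (λ y y<x → <-trans (above y y<x) j<j'))

  stair-rowTies : ∀ i i' → i F.< i' → (∀ j → stair i j ≡ stair i' j) → ℓr i F.< ℓr i'
  stair-rowTies i i' i<i' same =
    rowsInc i i' _ i<i' (proj₂ (leftmost i))
      (subst (LeftmostOne R i') (sym sameLeftmost) (proj₂ (leftmost i')))
    where
    c' : Fin (suc n)
    c' = proj₁ (leftmost i')
    Si'c' : stair i' c' ≡ false
    Si'c' = stair-false i' c' (above≢zero i<i') ≤-refl
    sameLeftmost : proj₁ (leftmost i) ≡ c'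
    sameLeftmost = toℕ-injective (≤-antisym (left-mono (<⇒≤ i<i'))
                     (proj₂ (stair-false⇒ i c' (trans (same c') Si'c'))))

  R⇒ribbonCell : ∀ i j → R i j ≡ true → RibbonCell stair i j
  R⇒ribbonCell i j Rij with one⇒between Rij | stair i j
  ... | _ , j≤r | true  = inj₁ (refl , λ i' next →
          stair-false i' j (next≢zero next) (subst (toℕ j ≤_) (right≡left-next next) j≤r))
  ... | l≤j , _ | false = inj₂ (refl , λ j' next →
          stair-true i j' (subst (left i <_) (sym next) (s≤s l≤j)))

  ribbonCell⇒R : ∀ i j → RibbonCell stair i j → R i j ≡ true
  ribbonCell⇒R i j (inj₁ (Sij , below)) = between⇒one left≤j j≤right
    where
    left≤j : left i ≤ toℕ j
    left≤j with stair-true⇒ i j Sij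
    ... | inj₁ refl = subst (_≤ toℕ j) (sym left-top) z≤n
    ... | inj₂ l<j  = <⇒≤ l<j
    j≤right : toℕ j ≤ right i
    j≤right with last-or-next i
    ... | inj₁ refl        = subst (toℕ j ≤_) (sym right-bottom) (toℕ≤pred[n] j)
    ... | inj₂ (i' , next) = subst (toℕ j ≤_) (sym (right≡left-next next))
                                   (proj₂ (stair-false⇒ i' j (below i' next)))
  ribbonCell⇒R i j (inj₂ (Sij , beside)) =
    between⇒one (≤-reflexive (sym j≡left)) (subst (_≤ right i) (sym j≡left) (left≤right i))
    where
    i≢0,j≤l : i ≢ zero × toℕ j ≤ left i
    i≢0,j≤l = stair-false⇒ i j Sij
    left≤j : left i ≤ toℕ j
    left≤j with last-or-next j
    ... | inj₁ refl        = subst (left i ≤_) (sym (toℕ-fromℕ n)) (left≤n i)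
    ... | inj₂ (j' , next) with stair-true⇒ i j' (beside j' next)
    ...   | inj₁ i≡0 = contradiction i≡0 (proj₁ i≢0,j≤l)
    ...   | inj₂ l<j' = s≤s⁻¹ (subst (left i <_) next l<j')
    j≡left : toℕ j ≡ left i
    j≡left = ≤-antisym (proj₂ i≢0,j≤l) left≤j

  rowSort : Fin (suc k) ↔ Fin (suc k)
  rowSort = ⤖⇒↔ (mk⤖ rowPerm)

  colSort : Fin (suc n) ↔ Fin (suc n)
  colSort = ⤖⇒↔ (mk⤖ colPerm)

  T : Tableau (suc k) (suc n)
  T a b = stair (Inverse.from rowSort a) (Inverse.from colSort b)

  T-sorted : ∀ i j → T (ℓr i) (ℓc j) ≡ stair i j
  T-sorted i j = cong₂ stair (Inverse.strictlyInverseʳ rowSort i) (Inverse.strictlyInverseʳ colSort j)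

  T-colSorted : ∀ a j → T a (ℓc j) ≡ stair (Inverse.from rowSort a) j
  T-colSorted a j = cong (stair (Inverse.from rowSort a)) (Inverse.strictlyInverseʳ colSort j)

  T-isEW : IsEW T
  T-isEW = IsEW-permute (↔-sym rowSort) (↔-sym colSort) unsortTop stair-isEW
    where
    ℓr₀ : ℓr zero ≡ zero
    ℓr₀ = toℕ-injective (firstRowV0 zero refl)
    unsortTop : Inverse.from rowSort zero ≡ zero
    unsortTop = begin
      Inverse.from rowSort zero       ≡⟨ cong (Inverse.from rowSort) ℓr₀ ⟨
      Inverse.from rowSort (ℓr zero)  ≡⟨ Inverse.strictlyInverseʳ rowSort zero ⟩
      zero                            ∎

  T-phiMapsTo : PhiMapsTo T R ℓr ℓc
  T-phiMapsTo = record
    { colPerm   = colPerm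
    ; step1     = λ a j c c<j f → trans (T-colSorted a c)
                    (stair-zerosLeft (Inverse.from rowSort a) c<j (trans (sym (T-colSorted a j)) f))
    ; step1ties = λ j j' j<j' same → stair-colTies j j' j<j' λ x →
                    trans (sym (T-sorted x j)) (trans (same (ℓr x)) (T-sorted x j'))
    ; rowPerm   = rowPerm
    ; step2     = λ i i' j i'<i t → trans (T-sorted i' j)
                    (stair-onesUp left-mono j i'<i (trans (sym (T-sorted i j)) t))
    ; step2ties = λ i i' i<i' same → stair-rowTies i i' i<i' λ j →
                    trans (sym (T-sorted i j)) (trans (same j) (T-sorted i' j))
    ; result    = λ i j → mk⇔
                    (RibbonCell-cong (λ a b → sym (T-sorted a b)) ∘ R⇒ribbonCell i j)
                    (ribbonCell⇒R i j ∘ RibbonCell-cong T-sorted)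
    }

theorem3p6 : ∀ (m n : ℕ) → 1 ≤ m → 1 ≤ n →
    ∀ (R : Tableau m n) (ℓr : RowLabelling m) (ℓc : ColLabelling n) →
    IsLRib R ℓr ℓc →
    ∃ λ (T : Tableau m n) → IsEW T × PhiMapsTo T R ℓr ℓc
theorem3p6 (suc k) (suc n) _ _ R ℓr ℓc L = T , T-isEW , T-phiMapsTo
  where open Preimage L
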